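{- Let $N\ge0$, $\mathcal B=\{V,U_N,U_{N-1},\ldots,U_0,D_1\}$, and $P_m(x)=\sum_{n\ge0}|\mathcal P_{\mathcal B}(m,n)|x^n$ for $m\in\{0,1\}$. Then $$P_0(x)=1+xP_0(x)\sum_{k=0}^N P_1(x)^k,\qquad P_1(x)=1+x\sum_{k=0}^{N+1}P_1(x)^k.$$
   Context: Steps: $V=(0,-1)$ and $S_k=(1,k)$; $U_k=S_k$ for $k\ge0$, $D_j=S_{ -j}$ for $j\ge1$. For a set of steps $\mathcal S$, an $\mathcal S$-path is a finite (possibly empty) sequence of steps from $\mathcal S$ starting at $(0,0)$. $\mathcal P_{\mathcal S}(m,n)$ is the set of $\mathcal S$-paths ending at $(n,-m)$ all of whose points except possibly the last lie on or above the $x$-axis. -}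

module Defs where

open import Data.Nat as ℕ using (ℕ; zero; suc; _∸_)
open import Data.Integer as ℤ using (ℤ; +_; -[1+_]; -_)
open import Data.List using (List; []; _∷_; _++_; map; concatMap; length; take; upTo; downFrom; filter)
open import Data.List.Relation.Unary.All using (All; all?)
open import Data.Product using (_×_)
open import Data.Nat.ListAction using (sum)
open import Relation.Nullary.Decidable using (Dec; _×-dec_)
open import Relation.Binary.PropositionalEquality using (_≡_)

-- Steps: V = (0,-1), S k = (1,k).

data Step : Set where
  V : Step
  S : ℤ → Step

U : ℕ → Step
U k = S (+ k)

D : ℕ → Step
D j = S (- (+ j))

B : ℕ → List Step
B N = V ∷ map U (downFrom (suc N)) ++ D 1 ∷ []

Path : Set
Path = List Step

endX : Path → ℕ
endX []          = 0
endX (V ∷ p)     = endX p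
endX (S _ ∷ p)   = suc (endX p)

endY : Path → ℤ
endY []          = + 0
endY (V ∷ p)     = -[1+ 0 ] ℤ.+ endY p
endY (S k ∷ p)   = k ℤ.+ endY p

-- p ∈ P(m,n) (apart from the step-set condition): p ends at (n,-m) and
-- every point except possibly the last one (i.e. the endpoint of every
-- proper prefix, including the start point) lies on or above the x-axis.
Valid : ℕ → ℕ → Path → Set
Valid m n p =
  endX p ≡ n × endY p ≡ - (+ m) ×
  All (λ i → + 0 ℤ.≤ endY (take i p)) (upTo (length p))

valid? : (m n : ℕ) (p : Path) → Dec (Valid m n p)
valid? m n p =
  (endX p ℕ.≟ n) ×-dec ((endY p ℤ.≟ - (+ m)) ×-dec
  all? (λ i → + 0 ℤ.≤? endY (take i p)) (upTo (length p)))

words : List Step → ℕ → List Path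
words A zero    = [] ∷ []
words A (suc k) = concatMap (λ a → map (a ∷_) (words A k)) A

wordsUpTo : List Step → ℕ → List Path
wordsUpTo A L = concatMap (words A) (upTo (suc L))

-- Every B-path in P_B(m,n) has exactly n non-V steps and
-- at most N*n + m V-steps (heights never exceed N*n and end at -m), so
-- its length is at most n + N*n + m; hence enumerating all B-words of
-- that length bound and filtering counts exactly the set P_B(m,n).
countP : (N m n : ℕ) → ℕ
countP N m n = length (filter (valid? m n) (wordsUpTo (B N) (n ℕ.+ N ℕ.* n ℕ.+ m)))

-- Formal power series over ℕ, as coefficient sequences.

PS : Set
PS = ℕ → ℕ

genP : ℕ → ℕ → PS
genP N m n = countP N m n

onePS : PS
onePS zero    = 1
onePS (suc _) = 0

_⊕_ : PS → PS → PS
(f ⊕ g) n = f n ℕ.+ g n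

_⊛_ : PS → PS → PS
(f ⊛ g) n = sum (map (λ i → f i ℕ.* g (n ∸ i)) (upTo (suc n)))

x⊛ : PS → PS
x⊛ f zero    = 0
x⊛ f (suc n) = f n

_^ps_ : PS → ℕ → PS
f ^ps zero  = onePS
f ^ps suc k = f ⊛ (f ^ps k)

sumPow : PS → ℕ → PS
sumPow f zero    = onePS
sumPow f (suc K) = sumPow f K ⊕ (f ^ps suc K)

{-# OPTIONS --safe #-}
-- Let E_h and Z_h be the generating series, by number of side steps, of the walks from height h
-- that end on their first visit to −1, resp. end at height 0. Cutting a walk from height a + 1 + h
-- at its first visit to height h gives E_{a+1+h} = E_a E_h and Z_{a+1+h} = E_a Z_h, hence
-- E_k = P₁^{k+1} and Z_k = P₁^k P₀. Splitting off the first step from height 0 (U_k leads to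
-- height k, D_1 to −1) yields both equations.
module Submission where

open import Defs
open import Data.Bool using (true; false; if_then_else_)
open import Data.Nat using (ℕ; zero; suc; _+_; _*_; _∸_; _≤_; _<_; z≤n; s≤s; s≤s⁻¹)
open import Data.Nat.Properties
open import Data.Nat.ListAction using (sum)
open import Data.Nat.ListAction.Properties using (sum-++)
open import Data.Integer as ℤ using (ℤ; +_; -[1+_]; -_)
import Data.Integer.Properties as ℤ
open import Data.List using (List; []; _∷_; _++_; map; concatMap; length; filter; take; upTo; applyUpTo; downFrom)
open import Data.List.Properties using (map-cong; map-∘; map-++; map-applyUpTo)
open import Data.List.Relation.Unary.All as All using (All; []; _∷_)
import Data.List.Relation.Unary.All.Properties as All
open import Data.Product using (_×_; _,_)
open import Function using (_∘_; _⇔_; mk⇔)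
open import Relation.Nullary using (Dec; does; no; map′)
open import Relation.Nullary.Decidable using (does-⇔)
open import Relation.Unary using (Decidable)
open import Relation.Binary.PropositionalEquality
open import Data.Nat.Tactic.RingSolver using (solve-∀)
open import Algebra.Properties.CommutativeSemigroup +-commutativeSemigroup using (interchange; xy∙z≈xz∙y)
open ≡-Reasoning

∑ : {A : Set} → List A → (A → ℕ) → ℕ
∑ xs f = sum (map f xs)

∑-cong : {A : Set} (xs : List A) {f g : A → ℕ} → f ≗ g → ∑ xs f ≡ ∑ xs g
∑-cong xs f≗g = cong sum (map-cong f≗g xs)

∑-zero : {A : Set} (xs : List A) → ∑ xs (λ _ → 0) ≡ 0
∑-zero []       = refl
∑-zero (_ ∷ xs) = ∑-zero xs

∑-++ : {A : Set} (xs ys : List A) (f : A → ℕ) → ∑ (xs ++ ys) f ≡ ∑ xs f + ∑ ys f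
∑-++ xs ys f = trans (cong sum (map-++ f xs ys)) (sum-++ (map f xs) (map f ys))

∑-map : {A B : Set} (g : A → B) (xs : List A) (f : B → ℕ) → ∑ (map g xs) f ≡ ∑ xs (f ∘ g)
∑-map g xs f = cong sum (sym (map-∘ xs))

∑-concatMap : {A B : Set} (g : A → List B) (xs : List A) (f : B → ℕ) →
              ∑ (concatMap g xs) f ≡ ∑ xs (λ x → ∑ (g x) f)
∑-concatMap g []       f = refl
∑-concatMap g (x ∷ xs) f = trans (∑-++ (g x) (concatMap g xs) f) (cong (_+_ (∑ (g x) f)) (∑-concatMap g xs f))

∑-+ : {A : Set} (xs : List A) (f g : A → ℕ) → ∑ xs (λ x → f x + g x) ≡ ∑ xs f + ∑ xs g
∑-+ []       f g = refl
∑-+ (x ∷ xs) f g = trans (cong (_+_ (f x + g x)) (∑-+ xs f g)) (interchange (f x) (g x) (∑ xs f) (∑ xs g))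

∑-swap : {A B : Set} (xs : List A) (ys : List B) (F : A → B → ℕ) →
         ∑ xs (λ x → ∑ ys (F x)) ≡ ∑ ys (λ y → ∑ xs (λ x → F x y))
∑-swap []       ys F = sym (∑-zero ys)
∑-swap (x ∷ xs) ys F = trans (cong (_+_ (∑ ys (F x))) (∑-swap xs ys F)) (sym (∑-+ ys (F x) _))

∑-applyUpTo-suc : (n : ℕ) (f : ℕ → ℕ) → ∑ (applyUpTo suc n) f ≡ ∑ (upTo n) (f ∘ suc)
∑-applyUpTo-suc n f = cong sum (trans (map-applyUpTo suc f n) (sym (map-applyUpTo (λ i → i) (f ∘ suc) n)))

𝟙 : {P : Set} → Dec P → ℕ
𝟙 P? = if does P? then 1 else 0

length-filter≡∑𝟙 : {A : Set} {P : A → Set} (P? : Decidable P) (xs : List A) →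
                   length (filter P? xs) ≡ ∑ xs (𝟙 ∘ P?)
length-filter≡∑𝟙 P? []       = refl
length-filter≡∑𝟙 P? (x ∷ xs) with does (P? x)
... | true  = cong suc (length-filter≡∑𝟙 P? xs)
... | false = length-filter≡∑𝟙 P? xs

sumTo : (ℕ → ℕ) → ℕ → ℕ
sumTo f zero    = f 0
sumTo f (suc K) = sumTo f K + f (suc K)

sumTo-cong : ∀ {f g} K → (∀ k → k ≤ K → f k ≡ g k) → sumTo f K ≡ sumTo g K
sumTo-cong zero    f≡g = f≡g 0 z≤n
sumTo-cong (suc K) f≡g = cong₂ _+_ (sumTo-cong K (λ k k≤K → f≡g k (m≤n⇒m≤1+n k≤K))) (f≡g (suc K) ≤-refl)

sumTo-zero : ∀ K → sumTo (λ _ → 0) K ≡ 0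
sumTo-zero zero    = refl
sumTo-zero (suc K) = trans (+-identityʳ _) (sumTo-zero K)

sumTo-suc : ∀ f K → sumTo f (suc K) ≡ f 0 + sumTo (f ∘ suc) K
sumTo-suc f zero    = refl
sumTo-suc f (suc K) = trans (cong (_+ f (suc (suc K))) (sumTo-suc f K)) (+-assoc (f 0) _ _)

∑-downFrom : ∀ f K → ∑ (downFrom (suc K)) f ≡ sumTo f K
∑-downFrom f zero    = +-identityʳ (f 0)
∑-downFrom f (suc K) = trans (cong (_+_ (f (suc K))) (∑-downFrom f K)) (+-comm (f (suc K)) _)

conv : PS → PS → PS
conv f g zero    = f 0 * g 0
conv f g (suc n) = f 0 * g (suc n) + conv (f ∘ suc) g n

⊛≗conv : ∀ f g → f ⊛ g ≗ conv f g
⊛≗conv f g zero    = +-identityʳ (f 0 * g 0)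
⊛≗conv f g (suc n) = cong (_+_ (f 0 * g (suc n))) (begin
  ∑ (applyUpTo suc (suc n)) (λ i → f i * g (suc n ∸ i)) ≡⟨ ∑-applyUpTo-suc (suc n) _ ⟩
  ((f ∘ suc) ⊛ g) n                                     ≡⟨ ⊛≗conv (f ∘ suc) g n ⟩
  conv (f ∘ suc) g n                                    ∎)

conv-cong : ∀ {f f′ g g′} → f ≗ f′ → g ≗ g′ → conv f g ≗ conv f′ g′
conv-cong f≗f′ g≗g′ zero    = cong₂ _*_ (f≗f′ 0) (g≗g′ 0)
conv-cong f≗f′ g≗g′ (suc n) = cong₂ _+_ (cong₂ _*_ (f≗f′ 0) (g≗g′ (suc n))) (conv-cong (f≗f′ ∘ suc) g≗g′ n)

conv-distribʳ : ∀ f f′ g n → conv (λ i → f i + f′ i) g n ≡ conv f g n + conv f′ g n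
conv-distribʳ f f′ g zero    = *-distribʳ-+ (g 0) (f 0) (f′ 0)
conv-distribʳ f f′ g (suc n) = begin
  (f 0 + f′ 0) * g (suc n) + conv (λ i → f (suc i) + f′ (suc i)) g n
    ≡⟨ cong₂ _+_ (*-distribʳ-+ (g (suc n)) (f 0) (f′ 0)) (conv-distribʳ (f ∘ suc) (f′ ∘ suc) g n) ⟩
  (f 0 * g (suc n) + f′ 0 * g (suc n)) + (conv (f ∘ suc) g n + conv (f′ ∘ suc) g n)
    ≡⟨ interchange (f 0 * g (suc n)) _ _ _ ⟩
  conv f g (suc n) + conv f′ g (suc n) ∎

conv-sumToˡ : ∀ (F : ℕ → PS) g K n → conv (λ i → sumTo (λ k → F k i) K) g n ≡ sumTo (λ k → conv (F k) g n) K
conv-sumToˡ F g zero    n = refl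
conv-sumToˡ F g (suc K) n =
  trans (conv-distribʳ _ (F (suc K)) g n) (cong (_+ conv (F (suc K)) g n) (conv-sumToˡ F g K n))

conv-zeroˡ : ∀ g → conv (λ _ → 0) g ≗ (λ _ → 0)
conv-zeroˡ g zero    = refl
conv-zeroˡ g (suc n) = conv-zeroˡ g n

conv-identityˡ : ∀ g → conv onePS g ≗ g
conv-identityˡ g zero    = +-identityʳ (g 0)
conv-identityˡ g (suc n) = trans (cong₂ _+_ (+-identityʳ (g (suc n))) (conv-zeroˡ g n)) (+-identityʳ (g (suc n)))

conv-identityʳ : ∀ f → conv f onePS ≗ f
conv-identityʳ f zero    = *-identityʳ (f 0)
conv-identityʳ f (suc n) = trans (cong (_+ conv (f ∘ suc) onePS n) (*-zeroʳ (f 0))) (conv-identityʳ (f ∘ suc) n)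

conv-suc : ∀ f g n → conv f g (suc n) ≡ conv f (g ∘ suc) n + f (suc n) * g 0
conv-suc f g zero    = refl
conv-suc f g (suc n) = trans (cong (_+_ (f 0 * g (suc (suc n)))) (conv-suc (f ∘ suc) g n))
                             (sym (+-assoc (f 0 * g (suc (suc n))) _ _))

conv-comm : ∀ f g → conv f g ≗ conv g f
conv-comm f g zero    = *-comm (f 0) (g 0)
conv-comm f g (suc n) = begin
  f 0 * g (suc n) + conv (f ∘ suc) g n ≡⟨ cong₂ _+_ (*-comm (f 0) (g (suc n))) (conv-comm (f ∘ suc) g n) ⟩
  g (suc n) * f 0 + conv g (f ∘ suc) n ≡⟨ +-comm (g (suc n) * f 0) _ ⟩
  conv g (f ∘ suc) n + g (suc n) * f 0 ≡⟨ conv-suc g f n ⟨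
  conv g f (suc n)                     ∎

sumPow≗sumTo : ∀ f K → sumPow f K ≗ (λ j → sumTo (λ k → (f ^ps k) j) K)
sumPow≗sumTo f zero    j = refl
sumPow≗sumTo f (suc K) j = cong (_+ (f ^ps suc K) j) (sumPow≗sumTo f K j)

module WalkCounts (N : ℕ) where

  -- walkCount onePS n h counts the walks from height h with n side steps that stay ≥ 0 until
  -- they end at −1, and walkCount (λ _ → 0) n h those that end at 0. The recursion follows the
  -- first step (V, U k or D 1); exit n counts the ways to finish from −1 with n side steps left.
  walkCount : (ℕ → ℕ) → ℕ → ℕ → ℕ
  walkCount exit zero    h       = 1
  walkCount exit (suc n) zero    = sumTo (walkCount exit n) N + exit n
  walkCount exit (suc n) (suc h) =
    walkCount exit (suc n) h + sumTo (λ k → walkCount exit n (suc h + k)) N + walkCount exit n h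

  walkSeries : (ℕ → ℕ) → ℕ → PS
  walkSeries exit h n = walkCount exit n h

  firstPassages : ℕ → PS
  firstPassages = walkSeries onePS

  conv-walkSeries-suc : ∀ exit a g n →
    conv (walkSeries exit (suc a) ∘ suc) g n
    ≡ conv (walkSeries exit a ∘ suc) g n + sumTo (λ k → conv (walkSeries exit (suc a + k)) g n) N + conv (walkSeries exit a) g n
  conv-walkSeries-suc exit a g n = begin
    conv (λ i → W (suc i) a + sumTo (λ k → W i (suc a + k)) N + W i a) g n
      ≡⟨ conv-distribʳ _ (walkSeries exit a) g n ⟩
    conv (λ i → W (suc i) a + sumTo (λ k → W i (suc a + k)) N) g n + conv (walkSeries exit a) g n
      ≡⟨ cong (_+ conv (walkSeries exit a) g n) (conv-distribʳ (walkSeries exit a ∘ suc) _ g n) ⟩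
    conv (walkSeries exit a ∘ suc) g n + conv (λ i → sumTo (λ k → W i (suc a + k)) N) g n + conv (walkSeries exit a) g n
      ≡⟨ cong (λ s → conv (walkSeries exit a ∘ suc) g n + s + conv (walkSeries exit a) g n)
              (conv-sumToˡ (λ k → walkSeries exit (suc a + k)) g N n) ⟩
    conv (walkSeries exit a ∘ suc) g n + sumTo (λ k → conv (walkSeries exit (suc a + k)) g n) N + conv (walkSeries exit a) g n ∎
    where W = walkCount exit

  walkSeries-firstPassage : ∀ exit a h → walkSeries exit (suc a + h) ≗ conv (firstPassages a) (walkSeries exit h)
  walkSeries-firstPassage exit a h zero = refl
  walkSeries-firstPassage exit zero h (suc n) = sym (begin
    1 * W (suc n) h + conv (λ i → sumTo (E i) N + onePS i) Wh n
      ≡⟨ cong₂ _+_ (*-identityˡ _) (conv-distribʳ (λ i → sumTo (E i) N) onePS Wh n) ⟩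
    W (suc n) h + (conv (λ i → sumTo (E i) N) Wh n + conv onePS Wh n)
      ≡⟨ cong (_+_ (W (suc n) h)) (cong₂ _+_ (conv-sumToˡ firstPassages Wh N n) (conv-identityˡ Wh n)) ⟩
    W (suc n) h + (sumTo (λ k → conv (firstPassages k) Wh n) N + W n h)
      ≡⟨ cong (λ s → W (suc n) h + (s + W n h)) (sumTo-cong N (λ k _ → passage k)) ⟩
    W (suc n) h + (sumTo (λ k → W n (suc h + k)) N + W n h)
      ≡⟨ +-assoc (W (suc n) h) _ _ ⟨
    W (suc n) (suc h) ∎)
    where
    W = walkCount exit
    Wh = walkSeries exit h
    E = walkCount onePS
    passage : ∀ k → conv (firstPassages k) Wh n ≡ W n (suc h + k)
    passage k = trans (sym (walkSeries-firstPassage exit k h n)) (cong (W n ∘ suc) (+-comm k h))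
  walkSeries-firstPassage exit (suc a) h (suc n) = sym (begin
    conv (firstPassages (suc a)) Wh (suc n)
      ≡⟨ cong (_+_ (1 * W (suc n) h)) (conv-walkSeries-suc onePS a Wh n) ⟩
    1 * W (suc n) h + (conv (Ea ∘ suc) Wh n + sumTo (λ k → conv (firstPassages (suc a + k)) Wh n) N + conv Ea Wh n)
      ≡⟨ regroup (1 * W (suc n) h) _ _ _ ⟩
    conv Ea Wh (suc n) + sumTo (λ k → conv (firstPassages (suc a + k)) Wh n) N + conv Ea Wh n
      ≡⟨ cong₂ _+_ (cong₂ _+_ (sym (walkSeries-firstPassage exit a h (suc n))) (sumTo-cong N (λ k _ → passage k)))
                   (sym (walkSeries-firstPassage exit a h n)) ⟩
    W (suc n) (suc (suc a + h)) ∎)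
    where
    W = walkCount exit
    Wh = walkSeries exit h
    Ea = firstPassages a
    regroup : ∀ p q r s → p + (q + r + s) ≡ p + q + r + s
    regroup p q r s = trans (sym (+-assoc p (q + r) s)) (cong (_+ s) (sym (+-assoc p q r)))
    passage : ∀ k → conv (firstPassages (suc a + k)) Wh n ≡ W n (suc (suc a + h) + k)
    passage k = trans (sym (walkSeries-firstPassage exit (suc a + k) h n)) (cong (W n ∘ suc ∘ suc) (xy∙z≈xz∙y a k h))

  ^ps-firstPassages : ∀ {F} → F ≗ firstPassages 0 → ∀ k → F ^ps suc k ≗ firstPassages k
  ^ps-firstPassages {F} F≗E₀ zero    n = trans (⊛≗conv F onePS n) (trans (conv-identityʳ F n) (F≗E₀ n))
  ^ps-firstPassages {F} F≗E₀ (suc k) n = begin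
    (F ⊛ (F ^ps suc k)) n                 ≡⟨ ⊛≗conv F (F ^ps suc k) n ⟩
    conv F (F ^ps suc k) n                ≡⟨ conv-cong F≗E₀ (^ps-firstPassages F≗E₀ k) n ⟩
    conv (firstPassages 0) (firstPassages k) n ≡⟨ walkSeries-firstPassage onePS 0 k n ⟨
    firstPassages (suc k) n               ∎

  conv-^ps-walkSeries : ∀ {F G exit} → F ≗ firstPassages 0 → G ≗ walkSeries exit 0 →
                        ∀ k → conv (F ^ps k) G ≗ walkSeries exit k
  conv-^ps-walkSeries {G = G} F≗E₀ G≗W₀ zero    n = trans (conv-identityˡ G n) (G≗W₀ n)
  conv-^ps-walkSeries {F} {G} {exit} F≗E₀ G≗W₀ (suc k) n = begin
    conv (F ^ps suc k) G n                       ≡⟨ conv-cong (^ps-firstPassages F≗E₀ k) G≗W₀ n ⟩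
    conv (firstPassages k) (walkSeries exit 0) n ≡⟨ walkSeries-firstPassage exit k 0 n ⟨
    walkSeries exit (suc k + 0) n                ≡⟨ cong (λ h → walkSeries exit (suc h) n) (+-identityʳ k) ⟩
    walkSeries exit (suc k) n                    ∎

rise : Step → ℤ
rise V     = -[1+ 0 ]
rise (S k) = k

endY-∷ : ∀ a p → endY (a ∷ p) ≡ rise a ℤ.+ endY p
endY-∷ V     p = refl
endY-∷ (S k) p = refl

-- Walk t h n p: p leads from height h to height t with n side steps. Only its last point
-- may lie below the axis, because vert and side can only start from a height + h.
data Walk (t : ℤ) : ℤ → ℕ → Path → Set where
  stop : Walk t t 0 []
  vert : ∀ {h n p}   → Walk t (+ h ℤ.+ -[1+ 0 ]) n p → Walk t (+ h) n (V ∷ p)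
  side : ∀ {h n k p} → Walk t (+ h ℤ.+ k) n p → Walk t (+ h) (suc n) (S k ∷ p)

stop? : ∀ t h n → Dec (Walk t h n [])
stop? t h zero    = map′ (λ { refl → stop }) (λ { stop → refl }) (h ℤ.≟ t)
stop? t h (suc n) = no λ ()

walk? : ∀ t h n p → Dec (Walk t h n p)
walk? t h        n       []          = stop? t h n
walk? t -[1+ _ ] n       (_ ∷ _)     = no λ ()
walk? t (+ h)    n       (V ∷ p)     = map′ vert (λ { (vert w) → w }) (walk? t (+ h ℤ.+ -[1+ 0 ]) n p)
walk? t (+ h)    zero    (S k ∷ p)   = no λ ()
walk? t (+ h)    (suc n) (S k ∷ p)   = map′ side (λ { (side w) → w }) (walk? t (+ h ℤ.+ k) n p)

NonnegBeforeEnd : ℤ → Path → Set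
NonnegBeforeEnd h p = All (λ i → + 0 ℤ.≤ h ℤ.+ endY (take i p)) (upTo (length p))

+-endY-∷ : ∀ h a q → h ℤ.+ endY (a ∷ q) ≡ (h ℤ.+ rise a) ℤ.+ endY q
+-endY-∷ h a q = trans (cong (ℤ._+_ h) (endY-∷ a q)) (sym (ℤ.+-assoc h (rise a) (endY q)))

module _ (h : ℤ) (a : Step) (p : Path) where

  private
    upTo-suc : applyUpTo suc (length p) ≡ map suc (upTo (length p))
    upTo-suc = sym (map-applyUpTo (λ i → i) suc (length p))

  nonnegBeforeEnd-∷⁺ : + 0 ℤ.≤ h → NonnegBeforeEnd (h ℤ.+ rise a) p → NonnegBeforeEnd h (a ∷ p)
  nonnegBeforeEnd-∷⁺ 0≤h nn =
    subst (+ 0 ℤ.≤_) (sym (ℤ.+-identityʳ h)) 0≤h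
    ∷ subst (All _) (sym upTo-suc) (All.map⁺ (All.map (λ {i} → subst (+ 0 ℤ.≤_) (sym (+-endY-∷ h a (take i p)))) nn))

  nonnegBeforeEnd-∷⁻ : NonnegBeforeEnd h (a ∷ p) → + 0 ℤ.≤ h × NonnegBeforeEnd (h ℤ.+ rise a) p
  nonnegBeforeEnd-∷⁻ (0≤h ∷ nn) =
    subst (+ 0 ℤ.≤_) (ℤ.+-identityʳ h) 0≤h
    , All.map (λ {i} → subst (+ 0 ℤ.≤_) (+-endY-∷ h a (take i p))) (All.map⁻ (subst (All _) upTo-suc nn))

ValidFrom : ℤ → ℤ → ℕ → Path → Set
ValidFrom t h n p = endX p ≡ n × h ℤ.+ endY p ≡ t × NonnegBeforeEnd h p

walk⇒validFrom : ∀ {t h n p} → Walk t h n p → ValidFrom t h n p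
walk⇒validFrom {t} stop = refl , ℤ.+-identityʳ t , []
walk⇒validFrom {h = h} (vert {p = p} w) with x , y , nn ← walk⇒validFrom w =
  x , trans (+-endY-∷ h V p) y , nonnegBeforeEnd-∷⁺ h V p (ℤ.+≤+ z≤n) nn
walk⇒validFrom {h = h} (side {k = k} {p = p} w) with x , y , nn ← walk⇒validFrom w =
  cong suc x , trans (+-endY-∷ h (S k) p) y , nonnegBeforeEnd-∷⁺ h (S k) p (ℤ.+≤+ z≤n) nn

validFrom⇒walk : ∀ {t h n} p → ValidFrom t h n p → Walk t h n p
validFrom⇒walk {t} {h} [] (refl , y , _) = subst (λ h → Walk t h 0 []) (trans (sym y) (ℤ.+-identityʳ h)) stop
validFrom⇒walk {h = h} (V ∷ p) (x , y , nn) with nonnegBeforeEnd-∷⁻ h V p nn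
... | ℤ.+≤+ _ , nn′ = vert (validFrom⇒walk p (x , trans (sym (+-endY-∷ h V p)) y , nn′))
validFrom⇒walk {h = h} (S k ∷ p) (refl , y , nn) with nonnegBeforeEnd-∷⁻ h (S k) p nn
... | ℤ.+≤+ _ , nn′ = side (validFrom⇒walk p (refl , trans (sym (+-endY-∷ h (S k) p)) y , nn′))

valid⇔walk : ∀ m n p → Valid m n p ⇔ Walk (- + m) (+ 0) n p
valid⇔walk m n p = mk⇔ (validFrom⇒walk p ∘ toValidFrom) (fromValidFrom ∘ walk⇒validFrom)
  where
  0+ : ∀ q → + 0 ℤ.+ endY q ≡ endY q
  0+ q = ℤ.+-identityˡ (endY q)
  toValidFrom : Valid m n p → ValidFrom (- + m) (+ 0) n p
  toValidFrom (x , y , nn) = x , trans (0+ p) y , All.map (λ {i} → subst (+ 0 ℤ.≤_) (sym (0+ (take i p)))) nn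
  fromValidFrom : ValidFrom (- + m) (+ 0) n p → Valid m n p
  fromValidFrom (x , y , nn) = x , trans (sym (0+ p)) y , All.map (λ {i} → subst (+ 0 ℤ.≤_) (0+ (take i p))) nn

∑-words-suc : ∀ A k f → ∑ (words A (suc k)) f ≡ ∑ A (λ a → ∑ (words A k) (f ∘ (a ∷_)))
∑-words-suc A k f = trans (∑-concatMap _ A f) (∑-cong A (λ a → ∑-map (a ∷_) (words A k) f))

∑-wordsUpTo-suc : ∀ A L f → ∑ (wordsUpTo A (suc L)) f ≡ f [] + ∑ A (λ a → ∑ (wordsUpTo A L) (f ∘ (a ∷_)))
∑-wordsUpTo-suc A L f = begin
  ∑ (wordsUpTo A (suc L)) f
    ≡⟨ ∑-concatMap (words A) (upTo (suc (suc L))) f ⟩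
  (f [] + 0) + ∑ (applyUpTo suc (suc L)) (λ k → ∑ (words A k) f)
    ≡⟨ cong₂ _+_ (+-identityʳ (f [])) (∑-applyUpTo-suc (suc L) _) ⟩
  f [] + ∑ (upTo (suc L)) (λ k → ∑ (words A (suc k)) f)
    ≡⟨ cong (_+_ (f [])) (∑-cong (upTo (suc L)) (λ k → ∑-words-suc A k f)) ⟩
  f [] + ∑ (upTo (suc L)) (λ k → ∑ A (λ a → ∑ (words A k) (f ∘ (a ∷_))))
    ≡⟨ cong (_+_ (f [])) (∑-swap (upTo (suc L)) A _) ⟩
  f [] + ∑ A (λ a → ∑ (upTo (suc L)) (λ k → ∑ (words A k) (f ∘ (a ∷_))))
    ≡⟨ cong (_+_ (f [])) (∑-cong A (λ a → sym (∑-concatMap (words A) (upTo (suc L)) _))) ⟩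
  f [] + ∑ A (λ a → ∑ (wordsUpTo A L) (f ∘ (a ∷_))) ∎

∑-wordsUpTo-[] : ∀ A L {f} → (∀ a p → f (a ∷ p) ≡ 0) → ∑ (wordsUpTo A L) f ≡ f []
∑-wordsUpTo-[] A zero    {f} f∷≡0 = +-identityʳ (f [])
∑-wordsUpTo-[] A (suc L) {f} f∷≡0 = begin
  ∑ (wordsUpTo A (suc L)) f                         ≡⟨ ∑-wordsUpTo-suc A L f ⟩
  f [] + ∑ A (λ a → ∑ (wordsUpTo A L) (f ∘ (a ∷_))) ≡⟨ cong (_+_ (f [])) (∑-cong A vanish) ⟩
  f [] + ∑ A (λ _ → 0)                              ≡⟨ cong (_+_ (f [])) (∑-zero A) ⟩
  f [] + 0                                          ≡⟨ +-identityʳ (f []) ⟩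
  f []                                              ∎
  where
  vanish : ∀ a → ∑ (wordsUpTo A L) (f ∘ (a ∷_)) ≡ 0
  vanish a = trans (∑-cong (wordsUpTo A L) (f∷≡0 a)) (∑-zero (wordsUpTo A L))

∑-B : ∀ N F → ∑ (B N) F ≡ F V + sumTo (F ∘ U) N + F (D 1)
∑-B N F = begin
  F V + ∑ (map U (downFrom (suc N)) ++ D 1 ∷ []) F
    ≡⟨ cong (_+_ (F V)) (∑-++ (map U (downFrom (suc N))) (D 1 ∷ []) F) ⟩
  F V + (∑ (map U (downFrom (suc N))) F + (F (D 1) + 0))
    ≡⟨ cong (_+_ (F V)) (cong₂ _+_ (trans (∑-map U (downFrom (suc N)) F) (∑-downFrom (F ∘ U) N)) (+-identityʳ (F (D 1)))) ⟩
  F V + (sumTo (F ∘ U) N + F (D 1))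
    ≡⟨ +-assoc (F V) _ _ ⟨
  F V + sumTo (F ∘ U) N + F (D 1) ∎

countWalks : List Step → ℤ → ℤ → ℕ → ℕ → ℕ
countWalks A t h n L = ∑ (wordsUpTo A L) (𝟙 ∘ walk? t h n)

countWalks-below : ∀ A t j n L → countWalks A t -[1+ j ] n L ≡ 𝟙 (walk? t -[1+ j ] n [])
countWalks-below A t j n L = ∑-wordsUpTo-[] A L (λ _ _ → refl)

module _ (N : ℕ) (t : ℤ) (h : ℕ) (L : ℕ) where

  private
    startingWith : ℕ → Step → ℕ
    startingWith n a = ∑ (wordsUpTo (B N) L) (λ p → 𝟙 (walk? t (+ h) n (a ∷ p)))

  countWalks-vertical : countWalks (B N) t (+ h) 0 (suc L)
                        ≡ 𝟙 (stop? t (+ h) 0) + countWalks (B N) t (+ h ℤ.+ -[1+ 0 ]) 0 L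
  countWalks-vertical = begin
    countWalks (B N) t (+ h) 0 (suc L)
      ≡⟨ ∑-wordsUpTo-suc (B N) L (𝟙 ∘ walk? t (+ h) 0) ⟩
    𝟙 (stop? t (+ h) 0) + ∑ (B N) (startingWith 0)
      ≡⟨ cong (_+_ (𝟙 (stop? t (+ h) 0))) (∑-B N (startingWith 0)) ⟩
    𝟙 (stop? t (+ h) 0) + (startingWith 0 V + sumTo (startingWith 0 ∘ U) N + startingWith 0 (D 1))
      ≡⟨ cong (λ s → 𝟙 (stop? t (+ h) 0) + (startingWith 0 V + s + startingWith 0 (D 1)))
              (trans (sumTo-cong N (λ k _ → noSide (+ k))) (sumTo-zero N)) ⟩
    𝟙 (stop? t (+ h) 0) + (startingWith 0 V + 0 + startingWith 0 (D 1))
      ≡⟨ cong (_+_ (𝟙 (stop? t (+ h) 0)))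
              (trans (cong₂ _+_ (+-identityʳ (startingWith 0 V)) (noSide (- + 1))) (+-identityʳ (startingWith 0 V))) ⟩
    𝟙 (stop? t (+ h) 0) + countWalks (B N) t (+ h ℤ.+ -[1+ 0 ]) 0 L ∎
    where
    noSide : ∀ k → startingWith 0 (S k) ≡ 0
    noSide k = ∑-zero (wordsUpTo (B N) L)

  countWalks-step : ∀ n → countWalks (B N) t (+ h) (suc n) (suc L)
                    ≡ countWalks (B N) t (+ h ℤ.+ -[1+ 0 ]) (suc n) L
                      + sumTo (λ k → countWalks (B N) t (+ (h + k)) n L) N
                      + countWalks (B N) t (+ h ℤ.+ -[1+ 0 ]) n L
  countWalks-step n = trans (∑-wordsUpTo-suc (B N) L (𝟙 ∘ walk? t (+ h) (suc n))) (∑-B N (startingWith (suc n)))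

module Enumeration (N : ℕ) where
  open WalkCounts N

  exitAt : ℕ → ℕ → ℕ
  exitAt m n = 𝟙 (stop? (- + m) -[1+ 0 ] n)

  exitAt-1 : exitAt 1 ≗ onePS
  exitAt-1 zero    = refl
  exitAt-1 (suc n) = refl

  exitAt-0 : exitAt 0 ≗ (λ _ → 0)
  exitAt-0 zero    = refl
  exitAt-0 (suc n) = refl

  -- Side steps rise by at most N and V-steps fall by 1, so a walk from height h to −m with
  -- n side steps has at most h + m + n N V-steps, hence length at most longest m n h.
  longest : ℕ → ℕ → ℕ → ℕ
  longest m n h = h + (m + n * suc N)

  longest-side : ∀ m n h {k} → k ≤ N → longest m n (h + k) < longest m (suc n) h
  longest-side m n h {k} k≤N =
    ≤-trans (s≤s (+-monoˡ-≤ (m + n * suc N) (+-monoʳ-≤ h k≤N))) (≤-reflexive (rearrange h N m (n * suc N)))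
    where
    rearrange : ∀ h N m x → suc (h + N + (m + x)) ≡ h + (m + (suc N + x))
    rearrange = solve-∀

  longest-mono : ∀ m n h → longest m n h ≤ longest m (suc n) h
  longest-mono m n h = +-monoʳ-≤ h (+-monoʳ-≤ m (m≤n+m (n * suc N) (suc N)))

  countWalks≡walkCount : ∀ {m exit} → m ≤ 1 → exitAt m ≗ exit →
                         ∀ L n h → longest m n h ≤ L → countWalks (B N) (- + m) (+ h) n L ≡ walkCount exit n h
  countWalks≡walkCount {zero}  _ _ zero zero    zero    _  = refl
  countWalks≡walkCount {zero}  _ _ zero (suc n) zero    ()
  countWalks≡walkCount {suc _} _ _ zero n       zero    ()
  countWalks≡walkCount         _ _ zero n       (suc h) ()
  countWalks≡walkCount {m} m≤1 _ (suc L) zero zero _ = begin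
    countWalks (B N) (- + m) (+ 0) 0 (suc L)                           ≡⟨ countWalks-vertical N (- + m) 0 L ⟩
    𝟙 (stop? (- + m) (+ 0) 0) + countWalks (B N) (- + m) -[1+ 0 ] 0 L ≡⟨ cong (_+_ _) (countWalks-below (B N) (- + m) 0 0 L) ⟩
    𝟙 (stop? (- + m) (+ 0) 0) + exitAt m 0                            ≡⟨ landOrExit m≤1 ⟩
    1                                                                  ∎
    where
    landOrExit : ∀ {m} → m ≤ 1 → 𝟙 (stop? (- + m) (+ 0) 0) + exitAt m 0 ≡ 1
    landOrExit z≤n       = refl
    landOrExit (s≤s z≤n) = refl
  countWalks≡walkCount {m} m≤1 exit≗ (suc L) zero (suc h) b =
    trans (countWalks-vertical N (- + m) (suc h) L)
          (cong₂ _+_ (above m) (countWalks≡walkCount m≤1 exit≗ L zero h (s≤s⁻¹ b)))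
    where
    above : ∀ m → 𝟙 (stop? (- + m) (+ suc h) 0) ≡ 0
    above zero    = refl
    above (suc _) = refl
  countWalks≡walkCount {m} m≤1 exit≗ (suc L) (suc n) zero b =
    trans (countWalks-step N (- + m) 0 L n)
          (cong₂ _+_ (cong₂ _+_ (countWalks-below (B N) (- + m) 0 (suc n) L) (sumTo-cong N up))
                     (trans (countWalks-below (B N) (- + m) 0 n L) (exit≗ n)))
    where
    up : ∀ k → k ≤ N → countWalks (B N) (- + m) (+ k) n L ≡ walkCount _ n k
    up k k≤N = countWalks≡walkCount m≤1 exit≗ L n k (s≤s⁻¹ (≤-trans (longest-side m n 0 k≤N) b))
  countWalks≡walkCount {m} m≤1 exit≗ (suc L) (suc n) (suc h) b =
    trans (countWalks-step N (- + m) (suc h) L n)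
          (cong₂ _+_ (cong₂ _+_ (countWalks≡walkCount m≤1 exit≗ L (suc n) h b′) (sumTo-cong N up))
                     (countWalks≡walkCount m≤1 exit≗ L n h (≤-trans (longest-mono m n h) b′)))
    where
    b′ : longest m (suc n) h ≤ L
    b′ = s≤s⁻¹ b
    up : ∀ k → k ≤ N → countWalks (B N) (- + m) (+ (suc h + k)) n L ≡ walkCount _ n (suc h + k)
    up k k≤N = countWalks≡walkCount m≤1 exit≗ L n (suc h + k) (s≤s⁻¹ (≤-trans (longest-side m n (suc h) k≤N) b))

  genP≡walkSeries : ∀ {m exit} → m ≤ 1 → exitAt m ≗ exit → genP N m ≗ walkSeries exit 0
  genP≡walkSeries {m} {exit} m≤1 exit≗ n = begin
    length (filter (valid? m n) ws)       ≡⟨ length-filter≡∑𝟙 (valid? m n) ws ⟩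
    ∑ ws (𝟙 ∘ valid? m n)                 ≡⟨ ∑-cong ws (λ p → cong (λ b → if b then 1 else 0)
                                                 (does-⇔ (valid⇔walk m n p) (valid? m n p) (walk? (- + m) (+ 0) n p))) ⟩
    countWalks (B N) (- + m) (+ 0) n L₀   ≡⟨ countWalks≡walkCount m≤1 exit≗ L₀ n 0 (≤-reflexive (bound m n N)) ⟩
    walkCount exit n 0                    ∎
    where
    L₀ = n + N * n + m
    ws = wordsUpTo (B N) L₀
    bound : ∀ m n N → m + n * suc N ≡ n + N * n + m
    bound = solve-∀

module _ (N : ℕ) where
  open WalkCounts N
  open Enumeration N

  private
    P₀ P₁ : PS
    P₀ = genP N 0
    P₁ = genP N 1

    P₁≗E₀ : P₁ ≗ firstPassages 0
    P₁≗E₀ = genP≡walkSeries (s≤s z≤n) exitAt-1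

    P₀≗Z₀ : P₀ ≗ walkSeries (λ _ → 0) 0
    P₀≗Z₀ = genP≡walkSeries z≤n exitAt-0

  P₀-equation : ∀ n → P₀ n ≡ (onePS ⊕ x⊛ (P₀ ⊛ sumPow P₁ N)) n
  P₀-equation zero    = P₀≗Z₀ 0
  P₀-equation (suc n) = begin
    P₀ (suc n)                                      ≡⟨ P₀≗Z₀ (suc n) ⟩
    sumTo (walkCount (λ _ → 0) n) N + 0             ≡⟨ +-identityʳ _ ⟩
    sumTo (walkCount (λ _ → 0) n) N                 ≡⟨ sumTo-cong N (λ k _ → conv-^ps-walkSeries P₁≗E₀ P₀≗Z₀ k n) ⟨
    sumTo (λ k → conv (P₁ ^ps k) P₀ n) N            ≡⟨ conv-sumToˡ (P₁ ^ps_) P₀ N n ⟨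
    conv (λ j → sumTo (λ k → (P₁ ^ps k) j) N) P₀ n  ≡⟨ conv-cong (sumPow≗sumTo P₁ N) (λ _ → refl) n ⟨
    conv (sumPow P₁ N) P₀ n                         ≡⟨ conv-comm P₀ (sumPow P₁ N) n ⟨
    conv P₀ (sumPow P₁ N) n                         ≡⟨ ⊛≗conv P₀ (sumPow P₁ N) n ⟨
    (P₀ ⊛ sumPow P₁ N) n                            ∎

  P₁-equation : ∀ n → P₁ n ≡ (onePS ⊕ x⊛ (sumPow P₁ (suc N))) n
  P₁-equation zero    = P₁≗E₀ 0
  P₁-equation (suc n) = begin
    P₁ (suc n)                                     ≡⟨ P₁≗E₀ (suc n) ⟩
    sumTo (walkCount onePS n) N + onePS n          ≡⟨ +-comm _ (onePS n) ⟩
    onePS n + sumTo (walkCount onePS n) N          ≡⟨ cong (_+_ (onePS n)) (sumTo-cong N (λ k _ → ^ps-firstPassages P₁≗E₀ k n)) ⟨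
    onePS n + sumTo (λ k → (P₁ ^ps suc k) n) N     ≡⟨ sumTo-suc (λ k → (P₁ ^ps k) n) N ⟨
    sumTo (λ k → (P₁ ^ps k) n) (suc N)             ≡⟨ sumPow≗sumTo P₁ (suc N) n ⟨
    sumPow P₁ (suc N) n                            ∎

mainTheorem18 : (N : ℕ) →
    ((n : ℕ) → genP N 0 n ≡ (onePS ⊕ x⊛ (genP N 0 ⊛ sumPow (genP N 1) N)) n)
    × ((n : ℕ) → genP N 1 n ≡ (onePS ⊕ x⊛ (sumPow (genP N 1) (suc N))) n)
mainTheorem18 N = P₀-equation N , P₁-equation N
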